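{- For every MCCS term $P$, the MLLa formula $\lfloor P\rfloor$ (the asynchronous translation of $P$) has a unique cut-free proof (as a proof net). This proof is denoted $\lfloor P\rfloor^{\pi}$.
   Context: MCCS terms are generated by $P,Q ::= 1 \mid P\parallel Q \mid a.P \mid \bar a.P$, where $a$ ranges over channel names. MLLa formulas are generated by $A,B ::= \alpha \mid \alpha^\perp \mid A\otimes B \mid A⅋B \mid \mathsf{M}^+_a A \mid \mathsf{M}^-_a A$ ($\alpha$ propositional variables, $a$ channel names), with negation $(\alpha)^\perp=\alpha^\perp$, $(\alpha^\perp)^\perp=\alpha$, $(A\otimes B)^\perp=A^\perp⅋B^\perp$, $(A⅋B)^\perp=A^\perp\otimes B^\perp$, $(\mathsf M^+_aA)^\perp=\mathsf M^-_a(A^\perp)$, $(\mathsf M^-_aA)^\perp=\mathsf M^+_a(A^\perp)$. Proofs are those of the one-sided sequent calculus with rules axiom $\vdash A^\perp,A$, cut, $\otimes$ (from $\vdash\Gamma,A$ and $\vdash B,\Delta$ infer $\vdash\Gamma,A\otimes B,\Delta$), $⅋$ (from $\vdash\Gamma,A,B$ infer $\vdash\Gamma,A⅋B$), and modality rules (from $\vdash\Gamma,A$ infer $\vdash\Gamma,\mathsf M^+_aA$, resp. $\vdash\Gamma,\mathsf M^-_aA$), considered as proof nets (graphs obtained by translating sequent proofs, identifying proofs up to rule permutations). Asynchronous translation: $\lfloor 1\rfloor = \alpha^\perp⅋\alpha$, $\lfloor P\parallel Q\rfloor = \lfloor P\rfloor\otimes\lfloor Q\rfloor$, $\lfloor a.P\rfloor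 = \mathsf M^+_a\alpha^\perp⅋(\lfloor P\rfloor\otimes\alpha)$, $\lfloor \bar a.P\rfloor = (\lfloor P\rfloor\otimes\alpha^\perp)⅋\mathsf M^-_a\alpha$, where in each clause $\alpha$ is a fresh propositional variable. -}

module Defs where

open import Data.Nat using (ℕ; suc)
open import Data.List using (List; []; _∷_; _++_)
open import Data.Maybe using (Maybe; just; nothing)
open import Data.Product using (_×_; _,_; proj₁; Σ)
open import Data.Sum using (_⊎_)
open import Data.List.Membership.Propositional using (_∈_)
open import Data.List.Relation.Binary.Permutation.Propositional using (_↭_)
open import Relation.Binary.PropositionalEquality using (_≡_)

Chan : Set
Chan = ℕ

data Term : Set where
  one : Term
  _∥_ : Term → Term → Term
  inp : Chan → Term → Term
  out : Chan → Term → Term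

data Formula : Set where
  var  : ℕ → Formula
  var⊥ : ℕ → Formula
  _⊗_  : Formula → Formula → Formula
  _⅋_  : Formula → Formula → Formula
  M⁺   : Chan → Formula → Formula
  M⁻   : Chan → Formula → Formula

infixr 6 _⊗_
infixr 5 _⅋_

_⊥ : Formula → Formula
var x ⊥ = var⊥ x
var⊥ x ⊥ = var x
(A ⊗ B) ⊥ = (A ⊥) ⅋ (B ⊥)
(A ⅋ B) ⊥ = (A ⊥) ⊗ (B ⊥)
M⁺ a A ⊥ = M⁻ a (A ⊥)
M⁻ a A ⊥ = M⁺ a (A ⊥)

-- Asynchronous translation.  Fresh variables are produced by a counter:
-- translate P n returns the formula and the next unused variable.

translate : Term → ℕ → Formula × ℕ
translate one n = (var⊥ n ⅋ var n , suc n)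
translate (P ∥ Q) n with translate P n
... | (A , n₁) with translate Q n₁
... | (B , n₂) = (A ⊗ B , n₂)
translate (inp a P) n with translate P n
... | (A , n₁) = (M⁺ a (var⊥ n₁) ⅋ (A ⊗ var n₁) , suc n₁)
translate (out a P) n with translate P n
... | (A , n₁) = ((A ⊗ var⊥ n₁) ⅋ M⁻ a (var n₁) , suc n₁)

⌊_⌋ : Term → Formula
⌊ P ⌋ = proj₁ (translate P 0)

-- Subformula occurrences, addressed by paths from the root.

data Dir : Set where
  l r m : Dir     -- left / right child of ⊗,⅋ ; unique child of a modality

Address : Set
Address = List Dir

sub : Formula → Address → Maybe Formula
sub A [] = just A
sub (A ⊗ B) (l ∷ p) = sub A p
sub (A ⊗ B) (r ∷ p) = sub B p
sub (A ⅋ B) (l ∷ p) = sub A p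
sub (A ⅋ B) (r ∷ p) = sub B p
sub (M⁺ a A) (m ∷ p) = sub A p
sub (M⁻ a A) (m ∷ p) = sub A p
sub _ _ = nothing

-- Cut-free one-sided sequent proofs whose sequents consist of
-- subformula occurrences of a fixed root formula F (every formula in a
-- cut-free proof of ⊢ F is such an occurrence).  Sequents are lists,
-- taken up to permutation (exchange).

data CutFree (F : Formula) : List Address → Set where
  ax  : ∀ {Γ p q A} → sub F p ≡ just (A ⊥) → sub F q ≡ just A →
        Γ ↭ (p ∷ q ∷ []) → CutFree F Γ
  ⊗-r : ∀ {Γ Δ₁ Δ₂ p A B} → sub F p ≡ just (A ⊗ B) →
        Γ ↭ (p ∷ Δ₁ ++ Δ₂) →
        CutFree F ((p ++ l ∷ []) ∷ Δ₁) → CutFree F ((p ++ r ∷ []) ∷ Δ₂) →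
        CutFree F Γ
  ⅋-r : ∀ {Γ Δ p A B} → sub F p ≡ just (A ⅋ B) →
        Γ ↭ (p ∷ Δ) →
        CutFree F ((p ++ l ∷ []) ∷ (p ++ r ∷ []) ∷ Δ) → CutFree F Γ
  M⁺-r : ∀ {Γ Δ p a A} → sub F p ≡ just (M⁺ a A) →
        Γ ↭ (p ∷ Δ) → CutFree F ((p ++ m ∷ []) ∷ Δ) → CutFree F Γ
  M⁻-r : ∀ {Γ Δ p a A} → sub F p ≡ just (M⁻ a A) →
        Γ ↭ (p ∷ Δ) → CutFree F ((p ++ m ∷ []) ∷ Δ) → CutFree F Γ

CutFreeProof : Formula → Set
CutFreeProof F = CutFree F ([] ∷ [])

-- The proof net of a cut-free proof: the syntax tree of F (fixed) together
-- with the axiom links.  So a cut-free proof net is determined by its set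
-- of axiom links (unordered pairs of occurrences).

links : ∀ {F Γ} → CutFree F Γ → List (Address × Address)
links (ax {p = p} {q = q} _ _ _) = (p , q) ∷ []
links (⊗-r _ _ π₁ π₂) = links π₁ ++ links π₂
links (⅋-r _ _ π) = links π
links (M⁺-r _ _ π) = links π
links (M⁻-r _ _ π) = links π

Linked : ∀ {F Γ} → CutFree F Γ → Address → Address → Set
Linked π p q = ((p , q) ∈ links π) ⊎ ((q , p) ∈ links π)

SameNet : ∀ {F Γ} → CutFree F Γ → CutFree F Γ → Set
SameNet π π′ = ∀ p q → (Linked π p q → Linked π′ p q) × (Linked π′ p q → Linked π p q)

-- ⌊ P ⌋ has an evident cut-free proof, built along the structure of P.
-- For uniqueness, two facts about ⌊ P ⌋ suffice, both consequences of the
-- freshness of the variables: a subformula and its dual occur together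
-- only when they are atoms, and every atom occurs exactly once.  The first
-- forces every axiom of a cut-free proof to be atomic, so every atom
-- occurrence of ⌊ P ⌋ is the endpoint of an axiom link whose other
-- endpoint carries the dual atom.  By the second, that other endpoint is
-- determined, hence so are all the links.
module Submission where

open import Defs
open import Data.Empty using (⊥-elim)
open import Data.List using (List; []; _∷_; _++_)
open import Data.List.Properties using (++-assoc; ++-identityʳ)
open import Data.List.Membership.Propositional using (_∈_)
open import Data.List.Membership.Propositional.Properties using (∈-++⁺ˡ; ∈-++⁺ʳ; ∈-++⁻)
open import Data.List.Relation.Binary.Subset.Propositional.Properties using (xs⊆x∷xs; ++⁺)
open import Data.List.Relation.Unary.Any using (here; there)
open import Data.List.Relation.Binary.Permutation.Propositional using (_↭_; refl; swap)
open import Data.List.Relation.Binary.Permutation.Propositional.Properties using (∈-resp-↭)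
open import Data.Maybe using (just)
open import Data.Maybe.Properties using (just-injective)
open import Data.Nat using (ℕ; suc; _+_; _≤_; _<_; s≤s)
open import Data.Nat.Properties
  using (≤-refl; ≤-trans; <-irrefl; ≤-<-trans; <-≤-trans; <⇒≤; <⇒≱; m≤m+n; m≤n+m; n<1+n; m≤n⇒m≤1+n; m<n⇒m<1+n)
open import Data.Product using (Σ; ∃; ∃₂; ∃-syntax; _×_; _,_; proj₁; proj₂; map₂)
open import Data.Sum using (_⊎_; inj₁; inj₂) renaming (map to ⊎-map)
open import Function using (_∘_)
open import Relation.Binary.PropositionalEquality using (_≡_; _≢_; refl; sym; trans; cong; subst)
open import Relation.Nullary using (¬_)

private
  variable
    a : Chan
    k n o : ℕ
    A B C F G T X : Formula
    d : Dir
    p q w : Address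
    Γ Δ : List Address
    V W : ℕ → Set

⊥-involutive : ∀ A → (A ⊥) ⊥ ≡ A
⊥-involutive (var k) = refl
⊥-involutive (var⊥ k) = refl
⊥-involutive (A ⊗ B) rewrite ⊥-involutive A | ⊥-involutive B = refl
⊥-involutive (A ⅋ B) rewrite ⊥-involutive A | ⊥-involutive B = refl
⊥-involutive (M⁺ a A) rewrite ⊥-involutive A = refl
⊥-involutive (M⁻ a A) rewrite ⊥-involutive A = refl

A≢A⊥ : ∀ A → A ≢ A ⊥
A≢A⊥ (var k) ()
A≢A⊥ (var⊥ k) ()
A≢A⊥ (A ⊗ B) ()
A≢A⊥ (A ⅋ B) ()
A≢A⊥ (M⁺ a A) ()
A≢A⊥ (M⁻ a A) ()

size : Formula → ℕ
size (var _) = 1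
size (var⊥ _) = 1
size (A ⊗ B) = suc (size A + size B)
size (A ⅋ B) = suc (size A + size B)
size (M⁺ _ A) = suc (size A)
size (M⁻ _ A) = suc (size A)

size-⊥ : ∀ A → size (A ⊥) ≡ size A
size-⊥ (var k) = refl
size-⊥ (var⊥ k) = refl
size-⊥ (A ⊗ B) rewrite size-⊥ A | size-⊥ B = refl
size-⊥ (A ⅋ B) rewrite size-⊥ A | size-⊥ B = refl
size-⊥ (M⁺ a A) rewrite size-⊥ A = refl
size-⊥ (M⁻ a A) rewrite size-⊥ A = refl

data IsAtom : Formula → Set where
  var  : IsAtom (var k)
  var⊥ : IsAtom (var⊥ k)

IsAtom-⊥ : IsAtom A → IsAtom (A ⊥)
IsAtom-⊥ var = var⊥
IsAtom-⊥ var⊥ = var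

data Child : Formula → Dir → Formula → Set where
  ⊗ˡ : Child (A ⊗ B) l A
  ⊗ʳ : Child (A ⊗ B) r B
  ⅋ˡ : Child (A ⅋ B) l A
  ⅋ʳ : Child (A ⅋ B) r B
  M⁺ : Child (M⁺ a A) m A
  M⁻ : Child (M⁻ a A) m A

-- The inductive form of sub F p ≡ just A.
data Occ : Formula → Address → Formula → Set where
  root : Occ F [] F
  step : Child F d G → Occ G p A → Occ F (d ∷ p) A

child-unique : Child F d G → Child F d C → G ≡ C
child-unique ⊗ˡ ⊗ˡ = refl
child-unique ⊗ʳ ⊗ʳ = refl
child-unique ⅋ˡ ⅋ˡ = refl
child-unique ⅋ʳ ⅋ʳ = refl
child-unique M⁺ M⁺ = refl
child-unique M⁻ M⁻ = refl

atom-childless : IsAtom F → ¬ Child F d G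
atom-childless var ()
atom-childless var⊥ ()

child-size : Child F d G → size G < size F
child-size (⊗ˡ {A = A} {B = B}) = s≤s (m≤m+n (size A) (size B))
child-size (⊗ʳ {A = A} {B = B}) = s≤s (m≤n+m (size B) (size A))
child-size (⅋ˡ {A = A} {B = B}) = s≤s (m≤m+n (size A) (size B))
child-size (⅋ʳ {A = A} {B = B}) = s≤s (m≤n+m (size B) (size A))
child-size (M⁺ {A = A}) = n<1+n (size A)
child-size (M⁻ {A = A}) = n<1+n (size A)

occ-size : Occ F p A → size A ≤ size F
occ-size root = ≤-refl
occ-size (step c ρ) = ≤-trans (occ-size ρ) (<⇒≤ (child-size c))

⊥-not-proper : Child F d G → Occ G p A → A ≢ F ⊥
⊥-not-proper {F} c ρ refl = <-irrefl (size-⊥ F) (≤-<-trans (occ-size ρ) (child-size c))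

occ-sub : sub F p ≡ just A → Occ F p A
occ-sub {p = []} refl = root
occ-sub {A ⊗ B} {l ∷ p} e = step ⊗ˡ (occ-sub e)
occ-sub {A ⊗ B} {r ∷ p} e = step ⊗ʳ (occ-sub e)
occ-sub {A ⅋ B} {l ∷ p} e = step ⅋ˡ (occ-sub e)
occ-sub {A ⅋ B} {r ∷ p} e = step ⅋ʳ (occ-sub e)
occ-sub {M⁺ a A} {m ∷ p} e = step M⁺ (occ-sub e)
occ-sub {M⁻ a A} {m ∷ p} e = step M⁻ (occ-sub e)
occ-sub {var _} {_ ∷ _} ()
occ-sub {var⊥ _} {_ ∷ _} ()
occ-sub {A ⊗ B} {m ∷ p} ()
occ-sub {A ⅋ B} {m ∷ p} ()
occ-sub {M⁺ a A} {l ∷ p} ()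
occ-sub {M⁺ a A} {r ∷ p} ()
occ-sub {M⁻ a A} {l ∷ p} ()
occ-sub {M⁻ a A} {r ∷ p} ()

sub-occ : Occ F p A → sub F p ≡ just A
sub-occ root = refl
sub-occ (step ⊗ˡ ρ) = sub-occ ρ
sub-occ (step ⊗ʳ ρ) = sub-occ ρ
sub-occ (step ⅋ˡ ρ) = sub-occ ρ
sub-occ (step ⅋ʳ ρ) = sub-occ ρ
sub-occ (step M⁺ ρ) = sub-occ ρ
sub-occ (step M⁻ ρ) = sub-occ ρ

occ-++⁺ : Occ F p A → Occ A w X → Occ F (p ++ w) X
occ-++⁺ root σ = σ
occ-++⁺ (step c ρ) σ = step c (occ-++⁺ ρ σ)

occ-++⁻ : Occ F p A → Occ F (p ++ w) X → Occ A w X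
occ-++⁻ root σ = σ
occ-++⁻ (step c ρ) (step c′ σ) with child-unique c c′
... | refl = occ-++⁻ ρ σ

sub-child : ∀ p → sub F p ≡ just A → Child A d G → sub F (p ++ d ∷ []) ≡ just G
sub-child p e c = sub-occ (occ-++⁺ (occ-sub {p = p} e) (step c root))

data AllVars (V : ℕ → Set) : Formula → Set where
  var  : V k → AllVars V (var k)
  var⊥ : V k → AllVars V (var⊥ k)
  _⊗_  : AllVars V A → AllVars V B → AllVars V (A ⊗ B)
  _⅋_  : AllVars V A → AllVars V B → AllVars V (A ⅋ B)
  M⁺   : AllVars V A → AllVars V (M⁺ a A)
  M⁻   : AllVars V A → AllVars V (M⁻ a A)

AllVars-mono : (∀ {k} → V k → W k) → AllVars V A → AllVars W A
AllVars-mono f (var v) = var (f v)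
AllVars-mono f (var⊥ v) = var⊥ (f v)
AllVars-mono f (vA ⊗ vB) = AllVars-mono f vA ⊗ AllVars-mono f vB
AllVars-mono f (vA ⅋ vB) = AllVars-mono f vA ⅋ AllVars-mono f vB
AllVars-mono f (M⁺ v) = M⁺ (AllVars-mono f v)
AllVars-mono f (M⁻ v) = M⁻ (AllVars-mono f v)

AllVars-⊥ : AllVars V (A ⊥) → AllVars V A
AllVars-⊥ {A = var _} (var⊥ v) = var v
AllVars-⊥ {A = var⊥ _} (var v) = var⊥ v
AllVars-⊥ {A = A ⊗ B} (vA ⅋ vB) = AllVars-⊥ vA ⊗ AllVars-⊥ vB
AllVars-⊥ {A = A ⅋ B} (vA ⊗ vB) = AllVars-⊥ vA ⅋ AllVars-⊥ vB
AllVars-⊥ {A = M⁺ _ A} (M⁻ v) = M⁺ (AllVars-⊥ v)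
AllVars-⊥ {A = M⁻ _ A} (M⁺ v) = M⁻ (AllVars-⊥ v)

AllVars-occ : AllVars V F → Occ F p A → AllVars V A
AllVars-occ v root = v
AllVars-occ (v ⊗ _) (step ⊗ˡ ρ) = AllVars-occ v ρ
AllVars-occ (_ ⊗ v) (step ⊗ʳ ρ) = AllVars-occ v ρ
AllVars-occ (v ⅋ _) (step ⅋ˡ ρ) = AllVars-occ v ρ
AllVars-occ (_ ⅋ v) (step ⅋ʳ ρ) = AllVars-occ v ρ
AllVars-occ (M⁺ v) (step M⁺ ρ) = AllVars-occ v ρ
AllVars-occ (M⁻ v) (step M⁻ ρ) = AllVars-occ v ρ

-- Every formula contains a variable.
AllVars-disjoint : (∀ {k} → V k → ¬ W k) → AllVars V A → ¬ AllVars W A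
AllVars-disjoint VW (var v) (var w) = VW v w
AllVars-disjoint VW (var⊥ v) (var⊥ w) = VW v w
AllVars-disjoint VW (v ⊗ _) (w ⊗ _) = AllVars-disjoint VW v w
AllVars-disjoint VW (v ⅋ _) (w ⅋ _) = AllVars-disjoint VW v w
AllVars-disjoint VW (M⁺ v) (M⁺ w) = AllVars-disjoint VW v w
AllVars-disjoint VW (M⁻ v) (M⁻ w) = AllVars-disjoint VW v w

-- Formulas with at most one cut-free proof net

DualFree : Formula → Formula → Set
DualFree L R = ∀ {p q B C} → Occ L p B → Occ R q C → C ≡ B ⊥ → IsAtom B

NoSharedAtom : Formula → Formula → Set
NoSharedAtom L R = ∀ {p q X} → IsAtom X → Occ L p X → ¬ Occ R q X

UniqueAtoms : Formula → Set
UniqueAtoms F = ∀ {p q X} → IsAtom X → Occ F p X → Occ F q X → p ≡ q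

Apart : Formula → Formula → Set
Apart L R = DualFree L R × NoSharedAtom L R

record Unambiguous (F : Formula) : Set where
  field
    dualFree    : DualFree F F
    uniqueAtoms : UniqueAtoms F

open Unambiguous

dualFree-sym : ∀ {L R} → DualFree L R → DualFree R L
dualFree-sym LR {B = B} ρ σ refl =
  subst IsAtom (⊥-involutive B) (IsAtom-⊥ (LR σ ρ (sym (⊥-involutive B))))

apart-sym : ∀ {L R} → Apart L R → Apart R L
apart-sym (LR , shared) = dualFree-sym LR , λ atom ρ σ → shared atom σ ρ

apart-separated : ∀ {L R b} → AllVars (_< b) L → AllVars (b ≤_) R → Apart L R
apart-separated {b = b} vL vR =
  (λ ρ σ → λ { refl → ⊥-elim (separated (AllVars-occ vL ρ) (AllVars-⊥ (AllVars-occ vR σ))) }) ,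
  λ _ ρ σ → separated (AllVars-occ vL ρ) (AllVars-occ vR σ)
  where
  separated : AllVars (_< b) A → ¬ AllVars (b ≤_) A
  separated = AllVars-disjoint <⇒≱

dualFree-node : (∀ {d d′ G C} → Child F d G → Child F d′ C → DualFree G C) → DualFree F F
dualFree-node {F} _ root root e = ⊥-elim (A≢A⊥ F e)
dualFree-node _ root (step c ρ) e = ⊥-elim (⊥-not-proper c ρ e)
dualFree-node _ {B = B} (step c ρ) root e =
  ⊥-elim (⊥-not-proper c ρ (trans (sym (⊥-involutive B)) (cong _⊥ (sym e))))
dualFree-node children (step c ρ) (step c′ σ) e = children c c′ ρ σ e

unambiguous-node : (∀ {d G} → Child F d G → Unambiguous G) →
                   (∀ {d d′ G C} → Child F d G → Child F d′ C → d ≡ d′ ⊎ Apart G C) →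
                   Unambiguous F
unambiguous-node {F} children siblings = record
  { dualFree = dualFree-node pair ; uniqueAtoms = unique }
  where
  pair : ∀ {d d′ G C} → Child F d G → Child F d′ C → DualFree G C
  pair c c′ with siblings c c′
  ... | inj₂ apart = proj₁ apart
  ... | inj₁ refl with child-unique c c′
  ...   | refl = dualFree (children c)

  unique : UniqueAtoms F
  unique _ root root = refl
  unique atom root (step c _) = ⊥-elim (atom-childless atom c)
  unique atom (step c _) root = ⊥-elim (atom-childless atom c)
  unique atom (step c ρ) (step c′ σ) with siblings c c′
  ... | inj₂ apart = ⊥-elim (proj₂ apart atom ρ σ)
  ... | inj₁ refl with child-unique c c′
  ...   | refl = cong (_ ∷_) (uniqueAtoms (children c) atom ρ σ)

unambiguous-atom : IsAtom A → Unambiguous A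
unambiguous-atom var = unambiguous-node (λ ()) (λ ())
unambiguous-atom var⊥ = unambiguous-node (λ ()) (λ ())

unambiguous-⊗ : Unambiguous A → Unambiguous B → Apart A B → Unambiguous (A ⊗ B)
unambiguous-⊗ uA uB AB = unambiguous-node (λ { ⊗ˡ → uA ; ⊗ʳ → uB }) λ
  { ⊗ˡ ⊗ˡ → inj₁ refl ; ⊗ˡ ⊗ʳ → inj₂ AB ; ⊗ʳ ⊗ˡ → inj₂ (apart-sym AB) ; ⊗ʳ ⊗ʳ → inj₁ refl }

unambiguous-⅋ : Unambiguous A → Unambiguous B → Apart A B → Unambiguous (A ⅋ B)
unambiguous-⅋ uA uB AB = unambiguous-node (λ { ⅋ˡ → uA ; ⅋ʳ → uB }) λ
  { ⅋ˡ ⅋ˡ → inj₁ refl ; ⅋ˡ ⅋ʳ → inj₂ AB ; ⅋ʳ ⅋ˡ → inj₂ (apart-sym AB) ; ⅋ʳ ⅋ʳ → inj₁ refl }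

unambiguous-M⁺ : Unambiguous A → Unambiguous (M⁺ a A)
unambiguous-M⁺ uA = unambiguous-node (λ { M⁺ → uA }) λ { M⁺ M⁺ → inj₁ refl }

unambiguous-M⁻ : Unambiguous A → Unambiguous (M⁻ a A)
unambiguous-M⁻ uA = unambiguous-node (λ { M⁻ → uA }) λ { M⁻ M⁻ → inj₁ refl }

-- The translation

formula : Term → ℕ → Formula
formula P n = proj₁ (translate P n)

next : Term → ℕ → ℕ
next P n = proj₂ (translate P n)

n≤next : ∀ P n → n ≤ next P n
n≤next one n = m≤n⇒m≤1+n ≤-refl
n≤next (P ∥ Q) n = ≤-trans (n≤next P n) (n≤next Q (next P n))
n≤next (inp a P) n = m≤n⇒m≤1+n (n≤next P n)
n≤next (out a P) n = m≤n⇒m≤1+n (n≤next P n)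

translate-vars : ∀ P n → AllVars (λ k → n ≤ k × k < next P n) (formula P n)
translate-vars one n = var⊥ (≤-refl , n<1+n n) ⅋ var (≤-refl , n<1+n n)
translate-vars (P ∥ Q) n =
  AllVars-mono (map₂ (λ k< → <-≤-trans k< (n≤next Q _))) (translate-vars P n) ⊗
  AllVars-mono (λ (≤k , k<) → ≤-trans (n≤next P n) ≤k , k<) (translate-vars Q _)
translate-vars (inp a P) n =
  M⁺ (var⊥ fresh) ⅋ (AllVars-mono (map₂ m<n⇒m<1+n) (translate-vars P n) ⊗ var fresh)
  where fresh = n≤next P n , n<1+n (next P n)
translate-vars (out a P) n =
  (AllVars-mono (map₂ m<n⇒m<1+n) (translate-vars P n) ⊗ var⊥ fresh) ⅋ M⁻ (var fresh)
  where fresh = n≤next P n , n<1+n (next P n)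

translate-below : ∀ P n → AllVars (_< next P n) (formula P n)
translate-below P n = AllVars-mono proj₂ (translate-vars P n)

translate-above : ∀ P n → AllVars (n ≤_) (formula P n)
translate-above P n = AllVars-mono proj₁ (translate-vars P n)

apart-dual-atoms : Apart (var⊥ k) (var k)
apart-dual-atoms = (λ { root _ _ → var⊥ ; (step () _) }) , λ { _ root (step () _) ; _ (step () _) }

apart-input : AllVars (_< o) T → Apart (M⁺ a (var⊥ o)) (T ⊗ var o)
apart-input {o} {T} vT = dualFree′ , noShared
  where
  dualFree′ : DualFree (M⁺ a (var⊥ o)) (T ⊗ var o)
  dualFree′ root (step ⊗ˡ σ) refl = ⊥-elim (AllVars-disjoint <⇒≱ (AllVars-occ vT σ) (M⁻ (var ≤-refl)))
  dualFree′ root (step ⊗ʳ (step () _)) refl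
  dualFree′ (step M⁺ root) _ _ = var⊥
  dualFree′ (step M⁺ (step () _)) _ _

  noShared : NoSharedAtom (M⁺ a (var⊥ o)) (T ⊗ var o)
  noShared _ (step M⁺ root) (step ⊗ˡ σ) = AllVars-disjoint <⇒≱ (AllVars-occ vT σ) (var⊥ ≤-refl)
  noShared _ (step M⁺ root) (step ⊗ʳ (step () _))
  noShared _ (step M⁺ (step () _))

apart-output : AllVars (_< o) T → Apart (T ⊗ var⊥ o) (M⁻ a (var o))
apart-output {o} {T} vT = apart-sym (dualFree′ , noShared)
  where
  dualFree′ : DualFree (M⁻ a (var o)) (T ⊗ var⊥ o)
  dualFree′ root (step ⊗ˡ σ) refl = ⊥-elim (AllVars-disjoint <⇒≱ (AllVars-occ vT σ) (M⁺ (var⊥ ≤-refl)))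
  dualFree′ root (step ⊗ʳ (step () _)) refl
  dualFree′ (step M⁻ root) _ _ = var
  dualFree′ (step M⁻ (step () _)) _ _

  noShared : NoSharedAtom (M⁻ a (var o)) (T ⊗ var⊥ o)
  noShared _ (step M⁻ root) (step ⊗ˡ σ) = AllVars-disjoint <⇒≱ (AllVars-occ vT σ) (var ≤-refl)
  noShared _ (step M⁻ root) (step ⊗ʳ (step () _))
  noShared _ (step M⁻ (step () _))

translate-unambiguous : ∀ P n → Unambiguous (formula P n)
translate-unambiguous one n = unambiguous-⅋ (unambiguous-atom var⊥) (unambiguous-atom var) apart-dual-atoms
translate-unambiguous (P ∥ Q) n =
  unambiguous-⊗ (translate-unambiguous P n) (translate-unambiguous Q (next P n))
                (apart-separated (translate-below P n) (translate-above Q (next P n)))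
translate-unambiguous (inp a P) n =
  unambiguous-⅋ (unambiguous-M⁺ (unambiguous-atom var⊥))
                (unambiguous-⊗ (translate-unambiguous P n) (unambiguous-atom var)
                               (apart-separated (translate-below P n) (var ≤-refl)))
                (apart-input (translate-below P n))
translate-unambiguous (out a P) n =
  unambiguous-⅋ (unambiguous-⊗ (translate-unambiguous P n) (unambiguous-atom var⊥)
                               (apart-separated (translate-below P n) (var⊥ ≤-refl)))
                (unambiguous-M⁻ (unambiguous-atom var))
                (apart-output (translate-below P n))

translate-proof : ∀ P n {F} p → sub F p ≡ just (formula P n) → CutFree F (p ∷ [])
translate-proof one n p e = ⅋-r e refl (ax (sub-child p e ⅋ˡ) (sub-child p e ⅋ʳ) refl)
translate-proof (P ∥ Q) n p e =
  ⊗-r {Δ₁ = []} {Δ₂ = []} e refl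
    (translate-proof P n _ (sub-child p e ⊗ˡ)) (translate-proof Q (next P n) _ (sub-child p e ⊗ʳ))
translate-proof (inp a P) n {F} p e =
  ⅋-r e refl
    (⊗-r {Δ₁ = []} {Δ₂ = pˡ ∷ []} eʳ (swap pˡ pʳ refl)
      (translate-proof P n _ (sub-child pʳ eʳ ⊗ˡ))
      (M⁺-r eˡ (swap _ _ refl) (ax (sub-child pˡ eˡ M⁺) (sub-child pʳ eʳ ⊗ʳ) refl)))
  where
  pˡ pʳ : Address
  pˡ = p ++ l ∷ []
  pʳ = p ++ r ∷ []
  eˡ : sub F pˡ ≡ just (M⁺ a (var⊥ (next P n)))
  eˡ = sub-child p e ⅋ˡ
  eʳ : sub F pʳ ≡ just (formula P n ⊗ var (next P n))
  eʳ = sub-child p e ⅋ʳ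
translate-proof (out a P) n {F} p e =
  ⅋-r e refl
    (⊗-r {Δ₁ = []} {Δ₂ = pʳ ∷ []} eˡ refl
      (translate-proof P n _ (sub-child pˡ eˡ ⊗ˡ))
      (M⁻-r eʳ (swap _ _ refl) (ax (sub-child pˡ eˡ ⊗ʳ) (sub-child pʳ eʳ M⁻) (swap _ _ refl))))
  where
  pˡ pʳ : Address
  pˡ = p ++ l ∷ []
  pʳ = p ++ r ∷ []
  eˡ : sub F pˡ ≡ just (formula P n ⊗ var⊥ (next P n))
  eˡ = sub-child p e ⅋ˡ
  eʳ : sub F pʳ ≡ just (M⁻ a (var (next P n)))
  eʳ = sub-child p e ⅋ʳ

-- Cut-free proofs of unambiguous formulas

axiom-atomic : DualFree F F → sub F p ≡ just (A ⊥) → sub F q ≡ just A → IsAtom A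
axiom-atomic {p = p} {q = q} dual e₁ e₂ = dual (occ-sub {p = q} e₂) (occ-sub {p = p} e₁) refl

link-atomic : ∀ {x y} → DualFree F F → (π : CutFree F Γ) → (x , y) ∈ links π →
              ∃[ A ] IsAtom A × sub F x ≡ just (A ⊥) × sub F y ≡ just A
link-atomic dual (ax {p = p} {q} e₁ e₂ _) (here refl) = _ , axiom-atomic {p = p} {q = q} dual e₁ e₂ , e₁ , e₂
link-atomic dual (ax _ _ _) (there ())
link-atomic dual (⊗-r _ _ π₁ π₂) i with ∈-++⁻ (links π₁) i
... | inj₁ i₁ = link-atomic dual π₁ i₁
... | inj₂ i₂ = link-atomic dual π₂ i₂
link-atomic dual (⅋-r _ _ π) i = link-atomic dual π i
link-atomic dual (M⁺-r _ _ π) i = link-atomic dual π i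
link-atomic dual (M⁻-r _ _ π) i = link-atomic dual π i

linked-atomic : ∀ {x y} → DualFree F F → (π : CutFree F Γ) → Linked π x y →
                ∃[ X ] IsAtom X × sub F x ≡ just X × sub F y ≡ just (X ⊥)
linked-atomic dual π (inj₁ i) with link-atomic dual π i
... | A , atom , ex , ey = A ⊥ , IsAtom-⊥ atom , ex , trans ey (cong just (sym (⊥-involutive A)))
linked-atomic dual π (inj₂ i) with link-atomic dual π i
... | A , atom , ey , ex = A , atom , ex , ey

linked-dual : ∀ {x z} → DualFree F F → (π : CutFree F Γ) → Linked π x z →
              sub F x ≡ just X → sub F z ≡ just (X ⊥)
linked-dual dual π xz ex with linked-atomic dual π xz
... | _ , _ , ex′ , ez with just-injective (trans (sym ex′) ex)
...   | refl = ez

Covers : Formula → List Address → List (Address × Address) → Set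
Covers F Γ Ls = ∀ {x w y X} → x ∈ Γ → x ++ w ≡ y → sub F y ≡ just X → IsAtom X →
                ∃[ z ] ((y , z) ∈ Ls ⊎ (z , y) ∈ Ls)

atom-leaf : sub F p ≡ just A → IsAtom A → sub F (p ++ w) ≡ just X → p ++ w ≡ p
atom-leaf {p = p} {w = w} eA atom eX with occ-++⁻ {w = w} (occ-sub eA) (occ-sub {p = p ++ w} eX)
... | root = ++-identityʳ p
... | step c _ = ⊥-elim (atom-childless atom c)

principal-child : sub F p ≡ just A → ¬ IsAtom A → sub F (p ++ w) ≡ just X → IsAtom X →
                  ∃₂ λ d w′ → w ≡ d ∷ w′ × ∃ (Child A d)
principal-child {p = p} {w = w} eA nonatomic eX atom with occ-++⁻ {w = w} (occ-sub eA) (occ-sub {p = p ++ w} eX)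
... | root = ⊥-elim (nonatomic atom)
... | step c _ = _ , _ , refl , _ , c

covers-axiom : IsAtom A → sub F p ≡ just (A ⊥) → sub F q ≡ just A → Γ ↭ p ∷ q ∷ [] →
               Covers F Γ ((p , q) ∷ [])
covers-axiom {p = p} {q = q} atom e₁ e₂ perm x∈Γ refl eX _ with ∈-resp-↭ perm x∈Γ
... | here refl = _ , inj₁ (here (cong (_, _) (atom-leaf {p = p} e₁ (IsAtom-⊥ atom) eX)))
... | there (here refl) = _ , inj₂ (here (cong (_ ,_) (atom-leaf {p = q} e₂ atom eX)))
... | there (there ())

covers-rule : ∀ {Γ′ Ls} → sub F p ≡ just A → ¬ IsAtom A → Γ ↭ p ∷ Δ →
              (∀ {d G} → Child A d G → p ++ d ∷ [] ∈ Γ′) → (∀ {x} → x ∈ Δ → x ∈ Γ′) →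
              Covers F Γ′ Ls → Covers F Γ Ls
covers-rule {p = p} eA nonatomic perm children side covers {w = w} x∈Γ refl eX atom with ∈-resp-↭ perm x∈Γ
... | there x∈Δ = covers (side x∈Δ) refl eX atom
... | here refl with principal-child {p = p} {w = w} eA nonatomic eX atom
...   | d , w′ , refl , _ , c = covers (children c) (++-assoc p (d ∷ []) w′) eX atom

covers-++ : ∀ {Γ₁ Γ₂ Ls₁ Ls₂} → Covers F Γ₁ Ls₁ → Covers F Γ₂ Ls₂ → Covers F (Γ₁ ++ Γ₂) (Ls₁ ++ Ls₂)
covers-++ {Γ₁ = Γ₁} covers₁ covers₂ x∈Γ e eX atom with ∈-++⁻ Γ₁ x∈Γ
... | inj₁ x∈Γ₁ = map₂ (⊎-map ∈-++⁺ˡ ∈-++⁺ˡ) (covers₁ x∈Γ₁ e eX atom)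
... | inj₂ x∈Γ₂ = map₂ (⊎-map (∈-++⁺ʳ _) (∈-++⁺ʳ _)) (covers₂ x∈Γ₂ e eX atom)

covered : DualFree F F → (π : CutFree F Γ) → Covers F Γ (links π)
covered dual (ax {p = p} {q} e₁ e₂ perm) = covers-axiom (axiom-atomic {p = p} {q = q} dual e₁ e₂) e₁ e₂ perm
covered dual (⊗-r {Δ₁ = Δ₁} {Δ₂} {p} e perm π₁ π₂) =
  covers-rule {Γ′ = Γ₁ ++ Γ₂} e (λ ()) perm (λ { ⊗ˡ → ∈-++⁺ˡ {ys = Γ₂} (here refl) ; ⊗ʳ → ∈-++⁺ʳ Γ₁ (here refl) })
              side (covers-++ {Γ₁ = Γ₁} (covered dual π₁) (covered dual π₂))
  where
  Γ₁ Γ₂ : List Address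
  Γ₁ = (p ++ l ∷ []) ∷ Δ₁
  Γ₂ = (p ++ r ∷ []) ∷ Δ₂
  side : ∀ {x} → x ∈ Δ₁ ++ Δ₂ → x ∈ Γ₁ ++ Γ₂
  side = ++⁺ (xs⊆x∷xs Δ₁ _) (xs⊆x∷xs Δ₂ _)
covered dual (⅋-r e perm π) =
  covers-rule e (λ ()) perm (λ { ⅋ˡ → here refl ; ⅋ʳ → there (here refl) }) (there ∘ there) (covered dual π)
covered dual (M⁺-r e perm π) = covers-rule e (λ ()) perm (λ { M⁺ → here refl }) there (covered dual π)
covered dual (M⁻-r e perm π) = covers-rule e (λ ()) perm (λ { M⁻ → here refl }) there (covered dual π)

linked-unique : ∀ {x y} → Unambiguous F → (π π′ : CutFreeProof F) → Linked π x y → Linked π′ x y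
linked-unique u π π′ xy with linked-atomic (dualFree u) π xy
... | X , atom , ex , ey with covered (dualFree u) π′ (here refl) refl ex atom
...   | _ , xz =
  subst (Linked π′ _) (uniqueAtoms u (IsAtom-⊥ atom) (occ-sub (linked-dual (dualFree u) π′ xz ex)) (occ-sub ey)) xz

unique-net : Unambiguous F → (π π′ : CutFreeProof F) → SameNet π π′
unique-net u π π′ _ _ = linked-unique u π π′ , linked-unique u π′ π

proposition12 : (P : Term) → Σ (CutFreeProof ⌊ P ⌋) (λ π → (π′ : CutFreeProof ⌊ P ⌋) → SameNet π π′)
proposition12 P = π , unique-net (translate-unambiguous P 0) π
  where
  π : CutFreeProof ⌊ P ⌋
  π = translate-proof P 0 [] refl
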